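{- Let $b\ge2$ and $g\ge3$ be integers and fix signs $s,t\in\{+1,-1\}$. Let $(d_1,d_2,l,m,n)$ be integers with $1\le d_1,d_2\le g-1$, $n\ge0$, $l,m\ge1$, satisfying $$(b+s)b^n+t=d_1\frac{g^l-1}{g-1}-d_2\frac{g^m-1}{g-1}.$$ Then $\Lambda_4:=\dfrac{(d_1g^{l-m}-d_2)g^m}{(g-1)(b+s)b^n}-1\ne0$. -}

module Defs where

open import Data.Nat as ℕ using (ℕ; zero; suc)
open import Data.Integer as ℤ using (ℤ; +_; -[1+_])
open import Data.Rational using (ℚ; 0ℚ; 1ℚ; _*_; 1/_; _/_; ≢-nonZero)
open import Data.Rational.Properties using (_≟_)
open import Relation.Nullary using (yes; no)

ι : ℤ → ℚ
ι z = z / 1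

-- total reciprocal: inv q = 1/q for q ≠ 0 (and 0 for q = 0; only ever
-- applied to nonzero arguments in the statement)
inv : ℚ → ℚ
inv q with q ≟ 0ℚ
... | yes _  = 0ℚ
... | no q≢0 = 1/_ q {{≢-nonZero q≢0}}

_^ℕ_ : ℚ → ℕ → ℚ
q ^ℕ zero  = 1ℚ
q ^ℕ suc k = q * (q ^ℕ k)

_^ℤ_ : ℚ → ℤ → ℚ
q ^ℤ (+ k)    = q ^ℕ k
q ^ℤ -[1+ k ] = inv (q ^ℕ suc k)

infixr 8 _^ℕ_ _^ℤ_

{-# OPTIONS --safe #-}
-- Multiplying the hypothesis by g − 1 turns it into
--   (g − 1)(b + s)bⁿ + (g − 1)t = (d₁gˡ − d₂gᵐ) − d₁ + d₂,
-- while Λ₄ = 0 says precisely d₁gˡ − d₂gᵐ = (g − 1)(b + s)bⁿ.  Hence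
-- (g − 1)t = d₂ − d₁, impossible for t = ±1 because |d₂ − d₁| ≤ g − 2.
module Submission where

open import Defs
open import Data.Nat as ℕ using (ℕ; _≤_; zero; suc)
import Data.Nat.Properties as ℕP
open import Data.Integer as ℤ using (ℤ; +_; _⊖_)
import Data.Integer.Properties as ℤP
open import Data.Rational using (ℚ; _+_; _-_; _*_; 0ℚ; 1ℚ; -_; 1/_; ≢-nonZero; toℚᵘ)
open import Data.Rational.Properties as ℚP using (_≟_)
import Data.Rational.Unnormalised as U
import Data.Rational.Unnormalised.Properties as UP
open import Data.Rational.Solver using (module +-*-Solver)
open import Algebra.Properties.Group ℚP.+-0-group using (x∙y⁻¹≈ε⇒x≈y)
open import Data.Sum using (_⊎_; inj₁; inj₂)
open import Data.Empty using (⊥-elim)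
open import Relation.Nullary using (yes; no)
open import Relation.Binary.PropositionalEquality

open +-*-Solver

toℚᵘ-ι : ∀ a → toℚᵘ (ι a) U.≃ U.mkℚᵘ a 0
toℚᵘ-ι a = ℚP.toℚᵘ-fromℚᵘ (U.mkℚᵘ a 0)

ι-injective : ∀ {a b} → ι a ≡ ι b → a ≡ b
ι-injective {a} {b} ιa≡ιb with ℚP.fromℚᵘ-injective {U.mkℚᵘ a 0} {U.mkℚᵘ b 0} ιa≡ιb
... | U.*≡* a*1≡b*1 = trans (sym (ℤP.*-identityʳ a)) (trans a*1≡b*1 (ℤP.*-identityʳ b))

ι-+ : ∀ a b → ι a + ι b ≡ ι (a ℤ.+ b)
ι-+ a b = ℚP.toℚᵘ-injective (begin
  toℚᵘ (ι a + ι b)            ≈⟨ ℚP.toℚᵘ-homo-+ (ι a) (ι b) ⟩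
  toℚᵘ (ι a) U.+ toℚᵘ (ι b)    ≈⟨ UP.+-cong (toℚᵘ-ι a) (toℚᵘ-ι b) ⟩
  U.mkℚᵘ a 0 U.+ U.mkℚᵘ b 0    ≈⟨ UP.≃-reflexive (cong (λ c → U.mkℚᵘ c 0)
                                    (cong₂ ℤ._+_ (ℤP.*-identityʳ a) (ℤP.*-identityʳ b))) ⟩
  U.mkℚᵘ (a ℤ.+ b) 0           ≈⟨ toℚᵘ-ι (a ℤ.+ b) ⟨
  toℚᵘ (ι (a ℤ.+ b))          ∎)
  where open UP.≃-Reasoning

*-≢0 : ∀ {p q} → p ≢ 0ℚ → q ≢ 0ℚ → p * q ≢ 0ℚ
*-≢0 {p} {q} p≢0 q≢0 pq≡0 = q≢0 (begin
  q                ≡⟨ sym (ℚP.*-identityˡ q) ⟩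
  1ℚ * q           ≡⟨ cong (_* q) (sym (ℚP.*-inverseˡ p {{≢-nonZero p≢0}})) ⟩
  1/ p * p * q     ≡⟨ ℚP.*-assoc (1/ p) p q ⟩
  1/ p * (p * q)   ≡⟨ cong (1/ p *_) pq≡0 ⟩
  1/ p * 0ℚ        ≡⟨ ℚP.*-zeroʳ (1/ p) ⟩
  0ℚ               ∎)
  where
  open ≡-Reasoning
  instance _ = ≢-nonZero p≢0

^ℕ-≢0 : ∀ {q} k → q ≢ 0ℚ → q ^ℕ k ≢ 0ℚ
^ℕ-≢0 zero    _   = ℚP.1≢0
^ℕ-≢0 (suc k) q≢0 = *-≢0 q≢0 (^ℕ-≢0 k q≢0)

inv-inverseˡ : ∀ {q} → q ≢ 0ℚ → inv q * q ≡ 1ℚ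
inv-inverseˡ {q} q≢0 with q ≟ 0ℚ
... | yes q≡0  = ⊥-elim (q≢0 q≡0)
... | no  q≢0′ = ℚP.*-inverseˡ q {{≢-nonZero q≢0′}}

*-inv≡1⇒≡ : ∀ {p q} → p * inv q ≡ 1ℚ → p ≡ q
*-inv≡1⇒≡ {p} {q} p/q≡1 = begin
  p                ≡⟨ sym (ℚP.*-identityʳ p) ⟩
  p * 1ℚ           ≡⟨ cong (p *_) (sym (inv-inverseˡ q≢0)) ⟩
  p * (inv q * q)  ≡⟨ sym (ℚP.*-assoc p (inv q) q) ⟩
  p * inv q * q    ≡⟨ cong (_* q) p/q≡1 ⟩
  1ℚ * q           ≡⟨ ℚP.*-identityˡ q ⟩
  q                ∎
  where
  open ≡-Reasoning
  q≢0 : q ≢ 0ℚ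
  q≢0 refl = ℚP.1≢0 (trans (sym p/q≡1) (ℚP.*-zeroʳ p))

^ℤ-[l-m]*^ℕm : ∀ {q} → q ≢ 0ℚ → ∀ l m → q ^ℤ (+ l ℤ.- + m) * q ^ℕ m ≡ q ^ℕ l
^ℤ-[l-m]*^ℕm {q} q≢0 l m = trans (cong (λ k → q ^ℤ k * q ^ℕ m) (ℤP.[+m]-[+n]≡m⊖n l m)) (^ℤ-⊖-*-^ℕ l m)
  where
  open ≡-Reasoning
  ^ℤ-⊖-*-^ℕ : ∀ l m → q ^ℤ (l ⊖ m) * q ^ℕ m ≡ q ^ℕ l
  ^ℤ-⊖-*-^ℕ l       zero    = ℚP.*-identityʳ (q ^ℕ l)
  ^ℤ-⊖-*-^ℕ zero    (suc m) = inv-inverseˡ (^ℕ-≢0 (suc m) q≢0)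
  ^ℤ-⊖-*-^ℕ (suc l) (suc m) = begin
    q ^ℤ (suc l ⊖ suc m) * (q * q ^ℕ m)  ≡⟨ cong (λ k → q ^ℤ k * (q * q ^ℕ m)) (ℤP.[1+m]⊖[1+n]≡m⊖n l m) ⟩
    q ^ℤ (l ⊖ m) * (q * q ^ℕ m)          ≡⟨ solve 3 (λ x y z → x :* (y :* z) := y :* (x :* z)) refl
                                               (q ^ℤ (l ⊖ m)) q (q ^ℕ m) ⟩
    q * (q ^ℤ (l ⊖ m) * q ^ℕ m)          ≡⟨ cong (q *_) (^ℤ-⊖-*-^ℕ l m) ⟩
    q * q ^ℕ l                           ∎

cancel-leading-terms : ∀ {u k t d₁ d₂ p q} → u ≢ 0ℚ →
  k + t ≡ d₁ * ((p - 1ℚ) * inv u) - d₂ * ((q - 1ℚ) * inv u) →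
  d₁ * p - d₂ * q ≡ u * k →
  u * t ≡ d₂ - d₁
cancel-leading-terms {u} {k} {t} {d₁} {d₂} {p} {q} u≢0 eq leading = begin
  u * t
    ≡⟨ solve 3 (λ u k t → u :* t := u :* (k :+ t) :- u :* k) refl u k t ⟩
  u * (k + t) - u * k
    ≡⟨ cong₂ (λ x y → u * x - y) eq (sym leading) ⟩
  u * (d₁ * ((p - 1ℚ) * inv u) - d₂ * ((q - 1ℚ) * inv u)) - (d₁ * p - d₂ * q)
    ≡⟨ solve 6 (λ u v d₁ d₂ p q →
         u :* (d₁ :* ((p :- con 1ℚ) :* v) :- d₂ :* ((q :- con 1ℚ) :* v)) :- (d₁ :* p :- d₂ :* q)
         := (d₁ :* (p :- con 1ℚ) :- d₂ :* (q :- con 1ℚ)) :* (v :* u) :- (d₁ :* p :- d₂ :* q))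
         refl u (inv u) d₁ d₂ p q ⟩
  (d₁ * (p - 1ℚ) - d₂ * (q - 1ℚ)) * (inv u * u) - (d₁ * p - d₂ * q)
    ≡⟨ cong (λ x → (d₁ * (p - 1ℚ) - d₂ * (q - 1ℚ)) * x - (d₁ * p - d₂ * q)) (inv-inverseˡ u≢0) ⟩
  (d₁ * (p - 1ℚ) - d₂ * (q - 1ℚ)) * 1ℚ - (d₁ * p - d₂ * q)
    ≡⟨ solve 4 (λ d₁ d₂ p q →
         (d₁ :* (p :- con 1ℚ) :- d₂ :* (q :- con 1ℚ)) :* con 1ℚ :- (d₁ :* p :- d₂ :* q) := d₂ :- d₁)
         refl d₁ d₂ p q ⟩
  d₂ - d₁
    ∎
  where open ≡-Reasoning

g+d≢d′+1 : ∀ {g d d′} → 1 ≤ g → 1 ≤ d → d′ ≤ g ℕ.∸ 1 → ι (+ g) + ι (+ d) ≢ ι (+ d′) + 1ℚ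
g+d≢d′+1 {g} {d} {d′} 1≤g 1≤d d′≤g-1 eq = ℕP.<⇒≢ d′+1<g+d (sym g+d≡d′+1)
  where
  d′+1<g+d : d′ ℕ.+ 1 ℕ.< g ℕ.+ d
  d′+1<g+d = ℕP.≤-<-trans (ℕP.m≤o∸n⇒m+n≤o d′ 1≤g d′≤g-1) (ℕP.m<m+n g 1≤d)
  g+d≡d′+1 : g ℕ.+ d ≡ d′ ℕ.+ 1
  g+d≡d′+1 = ℤP.+-injective (ι-injective (trans (sym (ι-+ (+ g) (+ d))) (trans eq (ι-+ (+ d′) (+ 1)))))

[g-1]*±1≢d₂-d₁ : ∀ {g d₁ d₂ t} → 1 ≤ g → 1 ≤ d₁ → d₁ ≤ g ℕ.∸ 1 → 1 ≤ d₂ → d₂ ≤ g ℕ.∸ 1 →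
  t ≡ + 1 ⊎ t ≡ ℤ.- + 1 → (ι (+ g) - 1ℚ) * ι t ≢ ι (+ d₂) - ι (+ d₁)
[g-1]*±1≢d₂-d₁ {g} {d₁} {d₂} 1≤g 1≤d₁ _ _ d₂≤g-1 (inj₁ refl) eq =
  g+d≢d′+1 1≤g 1≤d₁ d₂≤g-1 (begin
    G + D₁                    ≡⟨ solve 2 (λ G D₁ → G :+ D₁ := (G :- con 1ℚ) :* con 1ℚ :+ D₁ :+ con 1ℚ) refl G D₁ ⟩
    (G - 1ℚ) * 1ℚ + D₁ + 1ℚ   ≡⟨ cong (λ x → x + D₁ + 1ℚ) eq ⟩
    D₂ - D₁ + D₁ + 1ℚ         ≡⟨ solve 2 (λ D₁ D₂ → D₂ :- D₁ :+ D₁ :+ con 1ℚ := D₂ :+ con 1ℚ) refl D₁ D₂ ⟩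
    D₂ + 1ℚ                   ∎)
  where
  open ≡-Reasoning
  G = ι (+ g); D₁ = ι (+ d₁); D₂ = ι (+ d₂)
[g-1]*±1≢d₂-d₁ {g} {d₁} {d₂} 1≤g _ d₁≤g-1 1≤d₂ _ (inj₂ refl) eq =
  g+d≢d′+1 1≤g 1≤d₂ d₁≤g-1 (begin
    G + D₂                          ≡⟨ solve 2 (λ G D₂ → G :+ D₂ := con 1ℚ :- (G :- con 1ℚ) :* con (- 1ℚ) :+ D₂) refl G D₂ ⟩
    1ℚ - (G - 1ℚ) * (- 1ℚ) + D₂     ≡⟨ cong (λ x → 1ℚ - x + D₂) eq ⟩
    1ℚ - (D₂ - D₁) + D₂             ≡⟨ solve 2 (λ D₁ D₂ → con 1ℚ :- (D₂ :- D₁) :+ D₂ := D₁ :+ con 1ℚ) refl D₁ D₂ ⟩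
    D₁ + 1ℚ                         ∎)
  where
  open ≡-Reasoning
  G = ι (+ g); D₁ = ι (+ d₁); D₂ = ι (+ d₂)

lemma13 : (b g : ℕ) → 2 ≤ b → 3 ≤ g →
    (s t : ℤ) → (s ≡ ℤ.+ 1 ⊎ s ≡ ℤ.- ℤ.+ 1) → (t ≡ ℤ.+ 1 ⊎ t ≡ ℤ.- ℤ.+ 1) →
    (d₁ d₂ l m n : ℕ) →
    1 ≤ d₁ → d₁ ≤ g ℕ.∸ 1 → 1 ≤ d₂ → d₂ ≤ g ℕ.∸ 1 → 1 ≤ l → 1 ≤ m →
    (ι (+ b) + ι s) * ι (+ b) ^ℕ n + ι t
      ≡ ι (+ d₁) * ((ι (+ g) ^ℕ l - 1ℚ) * inv (ι (+ g) - 1ℚ))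
        - ι (+ d₂) * ((ι (+ g) ^ℕ m - 1ℚ) * inv (ι (+ g) - 1ℚ)) →
    ((ι (+ d₁) * ι (+ g) ^ℤ (+ l ℤ.- + m) - ι (+ d₂)) * ι (+ g) ^ℕ m)
      * inv ((ι (+ g) - 1ℚ) * (ι (+ b) + ι s) * ι (+ b) ^ℕ n) - 1ℚ
      ≢ 0ℚ
lemma13 b g _ 3≤g s t _ t≡±1 d₁ d₂ l m n 1≤d₁ d₁≤g-1 1≤d₂ d₂≤g-1 _ _ eq Λ≡0 =
  [g-1]*±1≢d₂-d₁ 1≤g 1≤d₁ d₁≤g-1 1≤d₂ d₂≤g-1 t≡±1
    (cancel-leading-terms {d₁ = D₁} {d₂ = D₂} {p = G ^ℕ l} {q = G ^ℕ m} G-1≢0 eq leading)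
  where
  open ≡-Reasoning
  G = ι (+ g); D₁ = ι (+ d₁); D₂ = ι (+ d₂); K = (ι (+ b) + ι s) * ι (+ b) ^ℕ n
  2≤g : 2 ≤ g
  2≤g = ℕP.≤-trans (ℕP.n≤1+n 2) 3≤g
  1≤g : 1 ≤ g
  1≤g = ℕP.≤-trans (ℕP.n≤1+n 1) 2≤g
  G≢0 : G ≢ 0ℚ
  G≢0 G≡0 = ℕP.>⇒≢ 1≤g (ℤP.+-injective (ι-injective G≡0))
  G-1≢0 : G - 1ℚ ≢ 0ℚ
  G-1≢0 G-1≡0 = ℕP.>⇒≢ 2≤g (ℤP.+-injective (ι-injective (x∙y⁻¹≈ε⇒x≈y G 1ℚ G-1≡0)))
  leading : D₁ * G ^ℕ l - D₂ * G ^ℕ m ≡ (G - 1ℚ) * K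
  leading = begin
    D₁ * G ^ℕ l - D₂ * G ^ℕ m
      ≡⟨ cong (λ x → D₁ * x - D₂ * G ^ℕ m) (sym (^ℤ-[l-m]*^ℕm G≢0 l m)) ⟩
    D₁ * (G ^ℤ (+ l ℤ.- + m) * G ^ℕ m) - D₂ * G ^ℕ m
      ≡⟨ solve 4 (λ D₁ D₂ E P → D₁ :* (E :* P) :- D₂ :* P := (D₁ :* E :- D₂) :* P)
           refl D₁ D₂ (G ^ℤ (+ l ℤ.- + m)) (G ^ℕ m) ⟩
    (D₁ * G ^ℤ (+ l ℤ.- + m) - D₂) * G ^ℕ m
      ≡⟨ *-inv≡1⇒≡ (x∙y⁻¹≈ε⇒x≈y _ 1ℚ Λ≡0) ⟩
    (G - 1ℚ) * (ι (+ b) + ι s) * ι (+ b) ^ℕ n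
      ≡⟨ ℚP.*-assoc (G - 1ℚ) (ι (+ b) + ι s) (ι (+ b) ^ℕ n) ⟩
    (G - 1ℚ) * K
      ∎
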